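{- Let $\Gamma$ be a set of patterns, $\psi$ a pattern, and $\varphi$ a sentence (a pattern with no free element variables). Then $\Gamma\cup\{\varphi\}\vdash_{\mathcal{MG}^c}\psi$ if and only if $\Gamma\vdash_{\mathcal{MG}^c}\lfloor\varphi\rfloor\to\psi$.
   Context: Fix a countably infinite set $EVar$ of element variables and a set $\Sigma$ of constant symbols containing a distinguished "definedness symbol" $\lceil\,\rceil$. Patterns: $\varphi::= x\mid \sigma\mid \bot\mid \neg\varphi\mid \varphi\to\varphi\mid \varphi\wedge\varphi\mid\varphi\vee\varphi\mid \varphi\cdot\varphi\mid \forall x\varphi\mid\exists x\varphi$ ($\varphi\cdot\psi$ is application). Abbreviations: $\varphi\leftrightarrow\psi:=(\varphi\to\psi)\wedge(\psi\to\varphi)$, $\lceil\varphi\rceil:=\lceil\,\rceil\cdot\varphi$, $\lfloor\varphi\rfloor:=\neg\lceil\neg\varphi\rceil$, $\varphi=\psi:=\lfloor\varphi\leftrightarrow\psi\rfloor$. An occurrence of $x$ is bound if inside a subpattern $\forall x\theta$ or $\exists x\theta$, otherwise free. $\Delta\vdash\psi$ iff there is a finite sequence ending in $\psi$ of axiom instances, elements of $\Delta$, or consequences of earlier members by a rule. Proof system $\mathcal{MG}^c$. Axioms: $\varphi\vee\varphi\to\varphi$; $\varphi\to\varphi\wedge\varphi$; $\varphi\to\varphi\vee\psi$; $\varphi\wedge\psi\to\varphi$; $\varphi\vee\psi\to\psi\vee\varphi$; $\varphi\wedge\psi\to\psi\wedge\varphi$; $\bot\to\varphi$; $\varphi\vee\neg\varphi$;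 $\neg\varphi\to(\varphi\to\bot)$; $(\varphi\to\bot)\to\neg\varphi$; $\forall x(\varphi\to\psi)\to(\forall x\varphi\to\forall x\psi)$; $\varphi\to\forall x\varphi$ if $x$ does not occur in $\varphi$; $\exists x(x=y)$ for $y$ distinct from $x$; $\exists x\varphi\to\neg\forall x\neg\varphi$; $\neg\forall x\neg\varphi\to\exists x\varphi$; $(\varphi\vee\psi)\cdot\chi\to\varphi\cdot\chi\vee\psi\cdot\chi$; $\chi\cdot(\varphi\vee\psi)\to\chi\cdot\varphi\vee\chi\cdot\psi$; $(\exists x\varphi)\cdot\psi\to\exists x(\varphi\cdot\psi)$ and $\psi\cdot(\exists x\varphi)\to\exists x(\psi\cdot\varphi)$ if $x$ does not occur in $\psi$; $\lceil\varphi\rceil\cdot\psi\to\lceil\varphi\rceil$; $\psi\cdot\lceil\varphi\rceil\to\lceil\varphi\rceil$; $\lceil x\rceil$; $\varphi\to\lceil\varphi\rceil$; $\lceil\bot\rceil\to\bot$. Rules: from $\varphi$, $\varphi\to\psi$ infer $\psi$; from $\varphi\to\psi$, $\psi\to\chi$ infer $\varphi\to\chi$; from $\varphi\wedge\psi\to\chi$ infer $\varphi\to(\psi\to\chi)$; from $\varphi\to(\psi\to\chi)$ infer $\varphi\wedge\psi\to\chi$; from $\varphi\to\psi$ infer $\chi\vee\varphi\to\chi\vee\psi$; from $\varphi$ infer $\forall x\varphi$; from $\varphi\to\psi$ infer $\varphi\cdot\chi\to\psi\cdot\chi$ and $\chi\cdot\varphi\to\chi\cdot\psi$. -}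

module Defs where

open import Data.Nat using (ℕ)
open import Data.Sum using (_⊎_)
open import Data.Product using (_×_)
open import Data.Empty using (⊥)
open import Relation.Binary.PropositionalEquality using (_≡_; _≢_)
open import Relation.Nullary using (¬_)

EVar : Set
EVar = ℕ

infixr 5 _⇒_
infixr 6 _∨_
infixr 7 _∧_
infixl 9 _·_

data Pattern (Σ : Set) : Set where
  var  : EVar → Pattern Σ
  sym  : Σ → Pattern Σ
  ⊥p   : Pattern Σ
  ¬p_  : Pattern Σ → Pattern Σ
  _⇒_  : Pattern Σ → Pattern Σ → Pattern Σ
  _∧_  : Pattern Σ → Pattern Σ → Pattern Σ
  _∨_  : Pattern Σ → Pattern Σ → Pattern Σ
  _·_  : Pattern Σ → Pattern Σ → Pattern Σ
  ∀p   : EVar → Pattern Σ → Pattern Σ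
  ∃p   : EVar → Pattern Σ → Pattern Σ

module _ {Σ : Set} where

  Occurs : EVar → Pattern Σ → Set
  Occurs x (var y)   = x ≡ y
  Occurs x (sym _)   = ⊥
  Occurs x ⊥p        = ⊥
  Occurs x (¬p φ)    = Occurs x φ
  Occurs x (φ ⇒ ψ)   = Occurs x φ ⊎ Occurs x ψ
  Occurs x (φ ∧ ψ)   = Occurs x φ ⊎ Occurs x ψ
  Occurs x (φ ∨ ψ)   = Occurs x φ ⊎ Occurs x ψ
  Occurs x (φ · ψ)   = Occurs x φ ⊎ Occurs x ψ
  Occurs x (∀p y φ)  = x ≡ y ⊎ Occurs x φ
  Occurs x (∃p y φ)  = x ≡ y ⊎ Occurs x φ

  FreeIn : EVar → Pattern Σ → Set
  FreeIn x (var y)   = x ≡ y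
  FreeIn x (sym _)   = ⊥
  FreeIn x ⊥p        = ⊥
  FreeIn x (¬p φ)    = FreeIn x φ
  FreeIn x (φ ⇒ ψ)   = FreeIn x φ ⊎ FreeIn x ψ
  FreeIn x (φ ∧ ψ)   = FreeIn x φ ⊎ FreeIn x ψ
  FreeIn x (φ ∨ ψ)   = FreeIn x φ ⊎ FreeIn x ψ
  FreeIn x (φ · ψ)   = FreeIn x φ ⊎ FreeIn x ψ
  FreeIn x (∀p y φ)  = x ≢ y × FreeIn x φ
  FreeIn x (∃p y φ)  = x ≢ y × FreeIn x φ

  Sentence : Pattern Σ → Set
  Sentence φ = ∀ x → ¬ FreeIn x φ

  _⟺_ : Pattern Σ → Pattern Σ → Pattern Σ
  φ ⟺ ψ = (φ ⇒ ψ) ∧ (ψ ⇒ φ)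

  PSet : Set₁
  PSet = Pattern Σ → Set

  _∪｛_｝ : PSet → Pattern Σ → PSet
  (Γ ∪｛ φ ｝) χ = Γ χ ⊎ χ ≡ φ

module Definedness {Σ : Set} (d : Σ) where

  ⌈_⌉ : Pattern Σ → Pattern Σ
  ⌈ φ ⌉ = sym d · φ

  ⌊_⌋ : Pattern Σ → Pattern Σ
  ⌊ φ ⌋ = ¬p ⌈ ¬p φ ⌉

  _≐_ : Pattern Σ → Pattern Σ → Pattern Σ
  φ ≐ ψ = ⌊ φ ⟺ ψ ⌋

  -- Derivability in MG^c from the set Δ (inductive derivations;
  -- equivalent to the finite-sequence definition).
  data _⊢_ (Δ : PSet) : Pattern Σ → Set where
    ax-∨-idem  : ∀ φ → Δ ⊢ (φ ∨ φ ⇒ φ)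
    ax-∧-dup   : ∀ φ → Δ ⊢ (φ ⇒ φ ∧ φ)
    ax-∨-intro : ∀ φ ψ → Δ ⊢ (φ ⇒ φ ∨ ψ)
    ax-∧-elim  : ∀ φ ψ → Δ ⊢ (φ ∧ ψ ⇒ φ)
    ax-∨-comm  : ∀ φ ψ → Δ ⊢ (φ ∨ ψ ⇒ ψ ∨ φ)
    ax-∧-comm  : ∀ φ ψ → Δ ⊢ (φ ∧ ψ ⇒ ψ ∧ φ)
    ax-⊥       : ∀ φ → Δ ⊢ (⊥p ⇒ φ)
    ax-lem     : ∀ φ → Δ ⊢ (φ ∨ ¬p φ)
    ax-¬-elim  : ∀ φ → Δ ⊢ (¬p φ ⇒ (φ ⇒ ⊥p))
    ax-¬-intro : ∀ φ → Δ ⊢ ((φ ⇒ ⊥p) ⇒ ¬p φ)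
    ax-∀-K     : ∀ x φ ψ → Δ ⊢ (∀p x (φ ⇒ ψ) ⇒ (∀p x φ ⇒ ∀p x ψ))
    ax-∀-vac   : ∀ x φ → ¬ Occurs x φ → Δ ⊢ (φ ⇒ ∀p x φ)
    ax-∃-eq    : ∀ x y → x ≢ y → Δ ⊢ ∃p x (var x ≐ var y)
    ax-∃-¬∀    : ∀ x φ → Δ ⊢ (∃p x φ ⇒ ¬p (∀p x (¬p φ)))
    ax-¬∀-∃    : ∀ x φ → Δ ⊢ (¬p (∀p x (¬p φ)) ⇒ ∃p x φ)
    ax-prop-∨ˡ : ∀ φ ψ χ → Δ ⊢ ((φ ∨ ψ) · χ ⇒ φ · χ ∨ ψ · χ)
    ax-prop-∨ʳ : ∀ φ ψ χ → Δ ⊢ (χ · (φ ∨ ψ) ⇒ χ · φ ∨ χ · ψ)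
    ax-prop-∃ˡ : ∀ x φ ψ → ¬ Occurs x ψ → Δ ⊢ ((∃p x φ) · ψ ⇒ ∃p x (φ · ψ))
    ax-prop-∃ʳ : ∀ x φ ψ → ¬ Occurs x ψ → Δ ⊢ (ψ · (∃p x φ) ⇒ ∃p x (ψ · φ))
    ax-⌈⌉ˡ     : ∀ φ ψ → Δ ⊢ (⌈ φ ⌉ · ψ ⇒ ⌈ φ ⌉)
    ax-⌈⌉ʳ     : ∀ φ ψ → Δ ⊢ (ψ · ⌈ φ ⌉ ⇒ ⌈ φ ⌉)
    ax-def-var : ∀ x → Δ ⊢ ⌈ var x ⌉
    ax-⌈⌉-intro : ∀ φ → Δ ⊢ (φ ⇒ ⌈ φ ⌉)
    ax-⌈⊥⌉     : Δ ⊢ (⌈ ⊥p ⌉ ⇒ ⊥p)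
    hyp        : ∀ {φ} → Δ φ → Δ ⊢ φ
    mp         : ∀ {φ ψ} → Δ ⊢ φ → Δ ⊢ (φ ⇒ ψ) → Δ ⊢ ψ
    syll       : ∀ {φ ψ χ} → Δ ⊢ (φ ⇒ ψ) → Δ ⊢ (ψ ⇒ χ) → Δ ⊢ (φ ⇒ χ)
    exp        : ∀ {φ ψ χ} → Δ ⊢ (φ ∧ ψ ⇒ χ) → Δ ⊢ (φ ⇒ (ψ ⇒ χ))
    imp        : ∀ {φ ψ χ} → Δ ⊢ (φ ⇒ (ψ ⇒ χ)) → Δ ⊢ (φ ∧ ψ ⇒ χ)
    ∨-mono     : ∀ {φ ψ} χ → Δ ⊢ (φ ⇒ ψ) → Δ ⊢ (χ ∨ φ ⇒ χ ∨ ψ)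
    gen        : ∀ {φ} x → Δ ⊢ φ → Δ ⊢ ∀p x φ
    frameˡ     : ∀ {φ ψ} χ → Δ ⊢ (φ ⇒ ψ) → Δ ⊢ (φ · χ ⇒ ψ · χ)
    frameʳ     : ∀ {φ ψ} χ → Δ ⊢ (φ ⇒ ψ) → Δ ⊢ (χ · φ ⇒ χ · ψ)

-- The converse direction is modus ponens with ⌊φ⌋, which follows from φ by necessitation.
-- The forward direction is by induction on derivations, carrying ⌊φ⌋ as a hypothesis.
-- Framing goes through because a predicate ⌊e⌋ can be pushed into either side of an
-- application: otherwise ⌈¬e⌉ would hold there and propagate outwards. Generalisation over x
-- needs ⌊φ⌋ → ∀x ⌊φ⌋; as the axiom χ → ∀x χ requires x not to occur in χ at all, this is
-- proved by renaming every occurrence of x, bound or free, to a fresh z, which yields a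
-- provably equivalent pattern. At binders of x the two quantifications are related through
-- the axiom ∃x (x = z).
module Submission where

open import Defs
open import Function.Base using (_∘_)
open import Function.Bundles using (_⇔_; mk⇔)
open import Data.Nat.Base using (suc; _≤_; _⊔_)
open import Data.Nat.Properties using (_≟_; ≤-refl; m≤n⇒m≤n⊔o; m≤n⇒m≤o⊔n; 1+n≰n)
open import Data.Sum.Base using (_⊎_; inj₁; inj₂; [_,_]′)
open import Data.Product.Base using (_×_; _,_; proj₁; proj₂)
open import Data.Empty using (⊥-elim)
open import Relation.Nullary using (¬_; yes; no)
open import Relation.Binary.PropositionalEquality as ≡ using (refl; _≢_)

module _ {Σ : Set} where

  maxVar : Pattern Σ → EVar
  maxVar (var y)  = y
  maxVar (sym _)  = 0
  maxVar ⊥p       = 0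
  maxVar (¬p a)   = maxVar a
  maxVar (a ⇒ b)  = maxVar a ⊔ maxVar b
  maxVar (a ∧ b)  = maxVar a ⊔ maxVar b
  maxVar (a ∨ b)  = maxVar a ⊔ maxVar b
  maxVar (a · b)  = maxVar a ⊔ maxVar b
  maxVar (∀p y a) = y ⊔ maxVar a
  maxVar (∃p y a) = y ⊔ maxVar a

  occurs⇒≤maxVar : ∀ {y} a → Occurs y a → y ≤ maxVar a
  occurs-either⇒≤⊔ : ∀ {y} a b → Occurs y a ⊎ Occurs y b → y ≤ maxVar a ⊔ maxVar b

  occurs⇒≤maxVar (var _)  refl = ≤-refl
  occurs⇒≤maxVar (¬p a)   o    = occurs⇒≤maxVar a o
  occurs⇒≤maxVar (a ⇒ b)  o    = occurs-either⇒≤⊔ a b o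
  occurs⇒≤maxVar (a ∧ b)  o    = occurs-either⇒≤⊔ a b o
  occurs⇒≤maxVar (a ∨ b)  o    = occurs-either⇒≤⊔ a b o
  occurs⇒≤maxVar (a · b)  o    = occurs-either⇒≤⊔ a b o
  occurs⇒≤maxVar (∀p y a) o    = occurs-either⇒≤⊔ (var y) a o
  occurs⇒≤maxVar (∃p y a) o    = occurs-either⇒≤⊔ (var y) a o

  occurs-either⇒≤⊔ a b (inj₁ o) = m≤n⇒m≤n⊔o (maxVar b) (occurs⇒≤maxVar a o)
  occurs-either⇒≤⊔ a b (inj₂ o) = m≤n⇒m≤o⊔n (maxVar a) (occurs⇒≤maxVar b o)

  fresh : Pattern Σ → EVar
  fresh a = suc (maxVar a)

  fresh-∉ : ∀ a → ¬ Occurs (fresh a) a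
  fresh-∉ a = 1+n≰n ∘ occurs⇒≤maxVar a

  renameVar : EVar → EVar → EVar → EVar
  renameVar x z y with y ≟ x
  ... | yes _ = z
  ... | no  _ = y

  rename : EVar → EVar → Pattern Σ → Pattern Σ
  rename x z (var y)  = var (renameVar x z y)
  rename x z (sym s)  = sym s
  rename x z ⊥p       = ⊥p
  rename x z (¬p a)   = ¬p (rename x z a)
  rename x z (a ⇒ b)  = rename x z a ⇒ rename x z b
  rename x z (a ∧ b)  = rename x z a ∧ rename x z b
  rename x z (a ∨ b)  = rename x z a ∨ rename x z b
  rename x z (a · b)  = rename x z a · rename x z b
  rename x z (∀p y a) = ∀p (renameVar x z y) (rename x z a)
  rename x z (∃p y a) = ∃p (renameVar x z y) (rename x z a)

  renameVar-≢ : ∀ {x z} → x ≢ z → ∀ y → x ≢ renameVar x z y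
  renameVar-≢ {x} x≢z y with y ≟ x
  ... | yes _   = x≢z
  ... | no  y≢x = y≢x ∘ ≡.sym

  rename-∉ : ∀ {x z} → x ≢ z → ∀ a → ¬ Occurs x (rename x z a)
  rename-∉ x≢z (var y)  = renameVar-≢ x≢z y
  rename-∉ x≢z (sym _)  ()
  rename-∉ x≢z ⊥p       ()
  rename-∉ x≢z (¬p a)   = rename-∉ x≢z a
  rename-∉ x≢z (a ⇒ b)  = [ rename-∉ x≢z a , rename-∉ x≢z b ]′
  rename-∉ x≢z (a ∧ b)  = [ rename-∉ x≢z a , rename-∉ x≢z b ]′
  rename-∉ x≢z (a ∨ b)  = [ rename-∉ x≢z a , rename-∉ x≢z b ]′
  rename-∉ x≢z (a · b)  = [ rename-∉ x≢z a , rename-∉ x≢z b ]′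
  rename-∉ x≢z (∀p y a) = [ renameVar-≢ x≢z y , rename-∉ x≢z a ]′
  rename-∉ x≢z (∃p y a) = [ renameVar-≢ x≢z y , rename-∉ x≢z a ]′

module _ {Σ : Set} (d : Σ) where
  open Definedness d

  ⊢-mono : ∀ {Δ Δ′ : PSet {Σ}} → (∀ {a} → Δ a → Δ′ a) → ∀ {a} → Δ ⊢ a → Δ′ ⊢ a
  ⊢-mono Δ⊆Δ′ (ax-∨-idem a)         = ax-∨-idem a
  ⊢-mono Δ⊆Δ′ (ax-∧-dup a)          = ax-∧-dup a
  ⊢-mono Δ⊆Δ′ (ax-∨-intro a b)      = ax-∨-intro a b
  ⊢-mono Δ⊆Δ′ (ax-∧-elim a b)       = ax-∧-elim a b
  ⊢-mono Δ⊆Δ′ (ax-∨-comm a b)       = ax-∨-comm a b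
  ⊢-mono Δ⊆Δ′ (ax-∧-comm a b)       = ax-∧-comm a b
  ⊢-mono Δ⊆Δ′ (ax-⊥ a)              = ax-⊥ a
  ⊢-mono Δ⊆Δ′ (ax-lem a)            = ax-lem a
  ⊢-mono Δ⊆Δ′ (ax-¬-elim a)         = ax-¬-elim a
  ⊢-mono Δ⊆Δ′ (ax-¬-intro a)        = ax-¬-intro a
  ⊢-mono Δ⊆Δ′ (ax-∀-K x a b)        = ax-∀-K x a b
  ⊢-mono Δ⊆Δ′ (ax-∀-vac x a x∉a)    = ax-∀-vac x a x∉a
  ⊢-mono Δ⊆Δ′ (ax-∃-eq x y x≢y)     = ax-∃-eq x y x≢y
  ⊢-mono Δ⊆Δ′ (ax-∃-¬∀ x a)         = ax-∃-¬∀ x a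
  ⊢-mono Δ⊆Δ′ (ax-¬∀-∃ x a)         = ax-¬∀-∃ x a
  ⊢-mono Δ⊆Δ′ (ax-prop-∨ˡ a b c)    = ax-prop-∨ˡ a b c
  ⊢-mono Δ⊆Δ′ (ax-prop-∨ʳ a b c)    = ax-prop-∨ʳ a b c
  ⊢-mono Δ⊆Δ′ (ax-prop-∃ˡ x a b x∉b) = ax-prop-∃ˡ x a b x∉b
  ⊢-mono Δ⊆Δ′ (ax-prop-∃ʳ x a b x∉b) = ax-prop-∃ʳ x a b x∉b
  ⊢-mono Δ⊆Δ′ (ax-⌈⌉ˡ a b)          = ax-⌈⌉ˡ a b
  ⊢-mono Δ⊆Δ′ (ax-⌈⌉ʳ a b)          = ax-⌈⌉ʳ a b
  ⊢-mono Δ⊆Δ′ (ax-def-var x)        = ax-def-var x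
  ⊢-mono Δ⊆Δ′ (ax-⌈⌉-intro a)       = ax-⌈⌉-intro a
  ⊢-mono Δ⊆Δ′ ax-⌈⊥⌉                = ax-⌈⊥⌉
  ⊢-mono Δ⊆Δ′ (hyp a∈Δ)             = hyp (Δ⊆Δ′ a∈Δ)
  ⊢-mono Δ⊆Δ′ (mp p q)              = mp (⊢-mono Δ⊆Δ′ p) (⊢-mono Δ⊆Δ′ q)
  ⊢-mono Δ⊆Δ′ (syll p q)            = syll (⊢-mono Δ⊆Δ′ p) (⊢-mono Δ⊆Δ′ q)
  ⊢-mono Δ⊆Δ′ (exp p)               = exp (⊢-mono Δ⊆Δ′ p)
  ⊢-mono Δ⊆Δ′ (imp p)               = imp (⊢-mono Δ⊆Δ′ p)
  ⊢-mono Δ⊆Δ′ (∨-mono c p)          = ∨-mono c (⊢-mono Δ⊆Δ′ p)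
  ⊢-mono Δ⊆Δ′ (gen x p)             = gen x (⊢-mono Δ⊆Δ′ p)
  ⊢-mono Δ⊆Δ′ (frameˡ c p)          = frameˡ c (⊢-mono Δ⊆Δ′ p)
  ⊢-mono Δ⊆Δ′ (frameʳ c p)          = frameʳ c (⊢-mono Δ⊆Δ′ p)

  module _ {Δ : PSet {Σ}} where

    ⇒-refl : ∀ a → Δ ⊢ (a ⇒ a)
    ⇒-refl a = syll (ax-∧-dup a) (ax-∧-elim a a)

    ⇒-swap : ∀ {h a b} → Δ ⊢ (h ⇒ (a ⇒ b)) → Δ ⊢ (a ⇒ (h ⇒ b))
    ⇒-swap {h} {a} p = exp (syll (ax-∧-comm a h) (imp p))

    ∨-elim : ∀ {a b c} → Δ ⊢ (a ⇒ c) → Δ ⊢ (b ⇒ c) → Δ ⊢ (a ∨ b ⇒ c)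
    ∨-elim {a} {c = c} p q =
      syll (∨-mono a q) (syll (ax-∨-comm a c) (syll (∨-mono c p) (ax-∨-idem c)))

    -- Δ ⊢ h ⇒ a is read as "a holds in the context h"; the context h ∧ a extends h by the
    -- assumption a, which varᶜ retrieves.
    constᶜ : ∀ {h a} → Δ ⊢ a → Δ ⊢ (h ⇒ a)
    constᶜ {h} {a} p = mp p (exp (ax-∧-elim a h))

    varᶜ : ∀ {h a} → Δ ⊢ (h ∧ a ⇒ a)
    varᶜ {h} {a} = syll (ax-∧-comm h a) (ax-∧-elim a h)

    weakenᶜ : ∀ {h a b} → Δ ⊢ (h ⇒ b) → Δ ⊢ (h ∧ a ⇒ b)
    weakenᶜ {h} {a} p = syll (ax-∧-elim h a) p

    appᶜ : ∀ {h a b} → Δ ⊢ (h ⇒ (a ⇒ b)) → Δ ⊢ (h ⇒ a) → Δ ⊢ (h ⇒ b)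
    appᶜ {h} p q = syll (ax-∧-dup h) (imp (syll q (⇒-swap p)))

    pairᶜ : ∀ {h a b} → Δ ⊢ (h ⇒ a) → Δ ⊢ (h ⇒ b) → Δ ⊢ (h ⇒ a ∧ b)
    pairᶜ {a = a} {b} p q = appᶜ (appᶜ (constᶜ (exp (⇒-refl (a ∧ b)))) p) q

    fstᶜ : ∀ {h a b} → Δ ⊢ (h ⇒ a ∧ b) → Δ ⊢ (h ⇒ a)
    fstᶜ p = syll p (ax-∧-elim _ _)

    sndᶜ : ∀ {h a b} → Δ ⊢ (h ⇒ a ∧ b) → Δ ⊢ (h ⇒ b)
    sndᶜ p = syll p varᶜ

    inlᶜ : ∀ {h a b} → Δ ⊢ (h ⇒ a) → Δ ⊢ (h ⇒ a ∨ b)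
    inlᶜ p = syll p (ax-∨-intro _ _)

    inrᶜ : ∀ {h a b} → Δ ⊢ (h ⇒ b) → Δ ⊢ (h ⇒ a ∨ b)
    inrᶜ {a = a} {b} p = syll p (syll (ax-∨-intro b a) (ax-∨-comm b a))

    caseᶜ : ∀ {h a b c} → Δ ⊢ (h ⇒ a ∨ b) → Δ ⊢ (h ∧ a ⇒ c) → Δ ⊢ (h ∧ b ⇒ c) → Δ ⊢ (h ⇒ c)
    caseᶜ p q r = appᶜ (⇒-swap (∨-elim (⇒-swap (exp q)) (⇒-swap (exp r)))) p

    ⊥-elimᶜ : ∀ {h a} → Δ ⊢ (h ⇒ ⊥p) → Δ ⊢ (h ⇒ a)
    ⊥-elimᶜ p = syll p (ax-⊥ _)

    ¬-elimᶜ : ∀ {h a} → Δ ⊢ (h ⇒ ¬p a) → Δ ⊢ (h ⇒ a) → Δ ⊢ (h ⇒ ⊥p)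
    ¬-elimᶜ p q = appᶜ (syll p (ax-¬-elim _)) q

    ¬-introᶜ : ∀ {h a} → Δ ⊢ (h ∧ a ⇒ ⊥p) → Δ ⊢ (h ⇒ ¬p a)
    ¬-introᶜ p = syll (exp p) (ax-¬-intro _)

    ¬¬-elimᶜ : ∀ {h a} → Δ ⊢ (h ⇒ ¬p (¬p a)) → Δ ⊢ (h ⇒ a)
    ¬¬-elimᶜ {a = a} p = caseᶜ (constᶜ (ax-lem a)) varᶜ (⊥-elimᶜ (¬-elimᶜ (weakenᶜ p) varᶜ))

    contrapose : ∀ {a b} → Δ ⊢ (a ⇒ b) → Δ ⊢ (¬p b ⇒ ¬p a)
    contrapose {a} {b} p = ¬-introᶜ (¬-elimᶜ (ax-∧-elim (¬p b) a) (syll varᶜ p))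

    ⇒-reflᶜ : ∀ {h a} → Δ ⊢ (h ⇒ (a ⇒ a))
    ⇒-reflᶜ = constᶜ (⇒-refl _)

    ⇒-transᶜ : ∀ {h a b c} → Δ ⊢ (h ⇒ (a ⇒ b)) → Δ ⊢ (h ⇒ (b ⇒ c)) → Δ ⊢ (h ⇒ (a ⇒ c))
    ⇒-transᶜ p q = exp (appᶜ (weakenᶜ q) (appᶜ (weakenᶜ p) varᶜ))

    ¬-monoᶜ : ∀ {h a b} → Δ ⊢ (h ⇒ (a ⇒ b)) → Δ ⊢ (h ⇒ (¬p b ⇒ ¬p a))
    ¬-monoᶜ p = exp (¬-introᶜ (¬-elimᶜ (weakenᶜ varᶜ) (appᶜ (weakenᶜ (weakenᶜ p)) varᶜ)))

    ⇒-monoᶜ : ∀ {h a a′ b b′} → Δ ⊢ (h ⇒ (a′ ⇒ a)) → Δ ⊢ (h ⇒ (b ⇒ b′)) →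
              Δ ⊢ (h ⇒ ((a ⇒ b) ⇒ (a′ ⇒ b′)))
    ⇒-monoᶜ p q = exp (exp (appᶜ (weakenᶜ (weakenᶜ q))
                                 (appᶜ (weakenᶜ varᶜ) (appᶜ (weakenᶜ (weakenᶜ p)) varᶜ))))

    ∧-monoᶜ : ∀ {h a a′ b b′} → Δ ⊢ (h ⇒ (a ⇒ a′)) → Δ ⊢ (h ⇒ (b ⇒ b′)) →
              Δ ⊢ (h ⇒ (a ∧ b ⇒ a′ ∧ b′))
    ∧-monoᶜ p q = exp (pairᶜ (appᶜ (weakenᶜ p) (fstᶜ varᶜ)) (appᶜ (weakenᶜ q) (sndᶜ varᶜ)))

    ∨-monoᶜ : ∀ {h a a′ b b′} → Δ ⊢ (h ⇒ (a ⇒ a′)) → Δ ⊢ (h ⇒ (b ⇒ b′)) →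
              Δ ⊢ (h ⇒ (a ∨ b ⇒ a′ ∨ b′))
    ∨-monoᶜ p q = exp (caseᶜ varᶜ (inlᶜ (appᶜ (weakenᶜ (weakenᶜ p)) varᶜ))
                                  (inrᶜ (appᶜ (weakenᶜ (weakenᶜ q)) varᶜ)))

    expᶜ : ∀ {h a b c} → Δ ⊢ (h ⇒ (a ∧ b ⇒ c)) → Δ ⊢ (h ⇒ (a ⇒ (b ⇒ c)))
    expᶜ p = exp (exp (appᶜ (weakenᶜ (weakenᶜ p)) (pairᶜ (weakenᶜ varᶜ) varᶜ)))

    impᶜ : ∀ {h a b c} → Δ ⊢ (h ⇒ (a ⇒ (b ⇒ c))) → Δ ⊢ (h ⇒ (a ∧ b ⇒ c))
    impᶜ p = exp (appᶜ (appᶜ (weakenᶜ p) (fstᶜ varᶜ)) (sndᶜ varᶜ))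

    ∀-mono : ∀ x {a b} → Δ ⊢ (a ⇒ b) → Δ ⊢ (∀p x a ⇒ ∀p x b)
    ∀-mono x {a} {b} p = mp (gen x p) (ax-∀-K x a b)

    genᶜ : ∀ x {h a} → Δ ⊢ (h ⇒ ∀p x h) → Δ ⊢ (h ⇒ a) → Δ ⊢ (h ⇒ ∀p x a)
    genᶜ x h⇒∀h p = syll h⇒∀h (∀-mono x p)

    ∀-monoᶜ : ∀ x {h a b} → Δ ⊢ (h ⇒ ∀p x h) → Δ ⊢ (h ⇒ (a ⇒ b)) →
              Δ ⊢ (h ⇒ (∀p x a ⇒ ∀p x b))
    ∀-monoᶜ x h⇒∀h p = syll (genᶜ x h⇒∀h p) (ax-∀-K x _ _)

    ∃-elim : ∀ x {a b} → ¬ Occurs x b → Δ ⊢ (a ⇒ b) → Δ ⊢ (∃p x a ⇒ b)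
    ∃-elim x {a} {b} x∉b p =
      syll (ax-∃-¬∀ x a)
           (¬¬-elimᶜ (contrapose (syll (ax-∀-vac x (¬p b) x∉b) (∀-mono x (contrapose p)))))

    ∀∧∃⇒∃ : ∀ x {a b c} → Δ ⊢ (a ∧ b ⇒ c) → Δ ⊢ (∀p x a ⇒ (∃p x b ⇒ ∃p x c))
    ∀∧∃⇒∃ x {a} {b} {c} p = exp (syll (¬-introᶜ (¬-elimᶜ ¬∀¬b ∀¬b)) (ax-¬∀-∃ x c))
      where
        ¬∀¬b : Δ ⊢ ((∀p x a ∧ ∃p x b) ∧ ∀p x (¬p c) ⇒ ¬p (∀p x (¬p b)))
        ¬∀¬b = syll (weakenᶜ varᶜ) (ax-∃-¬∀ x b)
        ¬c⇒¬b-under-∀ : Δ ⊢ (∀p x a ⇒ (∀p x (¬p c) ⇒ ∀p x (¬p b)))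
        ¬c⇒¬b-under-∀ = syll (∀-mono x (¬-monoᶜ (exp p))) (ax-∀-K x (¬p c) (¬p b))
        ∀¬b : Δ ⊢ ((∀p x a ∧ ∃p x b) ∧ ∀p x (¬p c) ⇒ ∀p x (¬p b))
        ∀¬b = appᶜ (syll (weakenᶜ (ax-∧-elim _ _)) ¬c⇒¬b-under-∀) varᶜ

    ∃-monoᶜ : ∀ x {h a b} → Δ ⊢ (h ⇒ ∀p x h) → Δ ⊢ (h ⇒ (a ⇒ b)) →
              Δ ⊢ (h ⇒ (∃p x a ⇒ ∃p x b))
    ∃-monoᶜ x h⇒∀h p = syll h⇒∀h (∀∧∃⇒∃ x (imp p))

    ⌊⌋-elim : ∀ a → Δ ⊢ (⌊ a ⌋ ⇒ a)
    ⌊⌋-elim a = ¬¬-elimᶜ (¬-introᶜ (¬-elimᶜ (ax-∧-elim ⌊ a ⌋ (¬p a))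
                                            (syll varᶜ (ax-⌈⌉-intro (¬p a)))))

    ⌊⌋-intro : ∀ {a} → Δ ⊢ a → Δ ⊢ ⌊ a ⌋
    ⌊⌋-intro {a} p =
      mp (syll (frameʳ (sym d) (¬-elimᶜ (⇒-refl (¬p a)) (constᶜ p))) ax-⌈⊥⌉) (ax-¬-intro ⌈ ¬p a ⌉)

    ⌊⌋-mono : ∀ {a b} → Δ ⊢ (a ⇒ b) → Δ ⊢ (⌊ a ⌋ ⇒ ⌊ b ⌋)
    ⌊⌋-mono p = contrapose (frameʳ (sym d) (contrapose p))

    ≐-sym : ∀ a b → Δ ⊢ ((a ≐ b) ⇒ (b ≐ a))
    ≐-sym a b = ⌊⌋-mono (ax-∧-comm _ _)

    record Frame : Set where
      field
        plug      : Pattern Σ → Pattern Σ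
        plug-mono : ∀ {a b} → Δ ⊢ (a ⇒ b) → Δ ⊢ (plug a ⇒ plug b)
        plug-∨    : ∀ a b → Δ ⊢ (plug (a ∨ b) ⇒ plug a ∨ plug b)
        plug-⌈⌉   : ∀ a → Δ ⊢ (plug ⌈ a ⌉ ⇒ ⌈ a ⌉)

    appFrameˡ : Pattern Σ → Frame
    appFrameˡ b = record
      { plug      = _· b
      ; plug-mono = frameˡ b
      ; plug-∨    = λ a a′ → ax-prop-∨ˡ a a′ b
      ; plug-⌈⌉   = λ a → ax-⌈⌉ˡ a b
      }

    appFrameʳ : Pattern Σ → Frame
    appFrameʳ b = record
      { plug      = b ·_
      ; plug-mono = frameʳ b
      ; plug-∨    = λ a a′ → ax-prop-∨ʳ a a′ b
      ; plug-⌈⌉   = λ a → ax-⌈⌉ʳ a b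
      }

    module _ (C : Frame) where
      open Frame C

      ⌊⌋-∧-plug : ∀ e a → Δ ⊢ (⌊ e ⌋ ∧ plug a ⇒ plug (⌊ e ⌋ ∧ a))
      ⌊⌋-∧-plug e a =
        caseᶜ (syll varᶜ (syll (plug-mono split) (plug-∨ _ _)))
              varᶜ
              (⊥-elimᶜ (¬-elimᶜ (weakenᶜ (ax-∧-elim ⌊ e ⌋ (plug a))) (syll varᶜ escape)))
        where
          split : Δ ⊢ (a ⇒ (⌊ e ⌋ ∧ a) ∨ (¬p ⌊ e ⌋ ∧ a))
          split = caseᶜ (constᶜ (ax-lem ⌊ e ⌋)) (inlᶜ (pairᶜ varᶜ (ax-∧-elim a _)))
                                               (inrᶜ (pairᶜ varᶜ (ax-∧-elim a _)))
          escape : Δ ⊢ (plug (¬p ⌊ e ⌋ ∧ a) ⇒ ⌈ ¬p e ⌉)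
          escape = syll (plug-mono (¬¬-elimᶜ (ax-∧-elim _ a))) (plug-⌈⌉ (¬p e))

      plug-monoᶜ : ∀ {e a b} → Δ ⊢ (⌊ e ⌋ ⇒ (a ⇒ b)) → Δ ⊢ (⌊ e ⌋ ⇒ (plug a ⇒ plug b))
      plug-monoᶜ {e} {a} p = exp (syll (⌊⌋-∧-plug e a) (plug-mono (imp p)))

    ·-monoᶜ : ∀ {e a a′ b b′} → Δ ⊢ (⌊ e ⌋ ⇒ (a ⇒ a′)) → Δ ⊢ (⌊ e ⌋ ⇒ (b ⇒ b′)) →
              Δ ⊢ (⌊ e ⌋ ⇒ (a · b ⇒ a′ · b′))
    ·-monoᶜ {a′ = a′} {b} p q = ⇒-transᶜ (plug-monoᶜ (appFrameˡ b) p) (plug-monoᶜ (appFrameʳ a′) q)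

    -- Instantiate ∀ x θ at an x equal to z, which exists by ax-∃-eq; θ′ does not mention x.
    ∀-rename : ∀ {x z θ θ′} → x ≢ z → ¬ Occurs z θ → ¬ Occurs x θ′ →
               Δ ⊢ ((var x ≐ var z) ⇒ (θ ⇒ θ′)) → Δ ⊢ (∀p x θ ⇒ ∀p z θ′)
    ∀-rename {x} {z} {θ} {θ′} x≢z z∉θ x∉θ′ p =
      syll (ax-∀-vac z (∀p x θ) [ x≢z ∘ ≡.sym , z∉θ ]′) (∀-mono z ∀θ⇒θ′)
      where
        ∀θ⇒θ′ : Δ ⊢ (∀p x θ ⇒ θ′)
        ∀θ⇒θ′ = syll (appᶜ (∀∧∃⇒∃ x (imp (⇒-swap p))) (constᶜ (ax-∃-eq x z x≢z)))
                     (∃-elim x x∉θ′ (⇒-refl θ′))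

    ∃-rename : ∀ {x z θ θ′} → x ≢ z → ¬ Occurs z θ → ¬ Occurs x θ′ →
               Δ ⊢ ((var z ≐ var x) ⇒ (θ ⇒ θ′)) → Δ ⊢ (∃p x θ ⇒ ∃p z θ′)
    ∃-rename {x} {z} {θ} {θ′} x≢z z∉θ x∉θ′ p =
      syll (ax-∃-¬∀ x θ)
           (syll (contrapose (∀-rename (x≢z ∘ ≡.sym) x∉θ′ z∉θ (¬-monoᶜ p))) (ax-¬∀-∃ z θ′))

    module _ {x z : EVar} (x≢z : x ≢ z) where

      -- The context is arbitrary because below a binder of x it has to become x ≐ z, while at
      -- the top level, where x is not free, any provable ⌊ e ⌋ will do.
      rename-equivᶜ : ∀ e → (∀ {y} → y ≢ x → y ≢ z → Δ ⊢ (⌊ e ⌋ ⇒ ∀p y ⌊ e ⌋)) →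
                      ∀ a → ¬ Occurs z a → (FreeIn x a → Δ ⊢ (⌊ e ⌋ ⇒ (var x ⟺ var z))) →
                      Δ ⊢ (⌊ e ⌋ ⇒ (a ⇒ rename x z a)) × Δ ⊢ (⌊ e ⌋ ⇒ (rename x z a ⇒ a))
      rename-equiv-under-≐ : ∀ a → ¬ Occurs z a →
                             Δ ⊢ ((var x ≐ var z) ⇒ (a ⇒ rename x z a)) ×
                             Δ ⊢ ((var x ≐ var z) ⇒ (rename x z a ⇒ a))

      rename-equivᶜ e e-∀ (var y) z∉a x-free with y ≟ x
      ... | yes refl = fstᶜ (x-free refl) , sndᶜ (x-free refl)
      ... | no  _    = ⇒-reflᶜ , ⇒-reflᶜ
      rename-equivᶜ e e-∀ (sym _) z∉a x-free = ⇒-reflᶜ , ⇒-reflᶜ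
      rename-equivᶜ e e-∀ ⊥p      z∉a x-free = ⇒-reflᶜ , ⇒-reflᶜ
      rename-equivᶜ e e-∀ (¬p a)  z∉a x-free =
        let (p , q) = rename-equivᶜ e e-∀ a z∉a x-free
        in ¬-monoᶜ q , ¬-monoᶜ p
      rename-equivᶜ e e-∀ (a ⇒ b) z∉a x-free =
        let (p , q)   = rename-equivᶜ e e-∀ a (z∉a ∘ inj₁) (x-free ∘ inj₁)
            (p′ , q′) = rename-equivᶜ e e-∀ b (z∉a ∘ inj₂) (x-free ∘ inj₂)
        in ⇒-monoᶜ q p′ , ⇒-monoᶜ p q′
      rename-equivᶜ e e-∀ (a ∧ b) z∉a x-free =
        let (p , q)   = rename-equivᶜ e e-∀ a (z∉a ∘ inj₁) (x-free ∘ inj₁)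
            (p′ , q′) = rename-equivᶜ e e-∀ b (z∉a ∘ inj₂) (x-free ∘ inj₂)
        in ∧-monoᶜ p p′ , ∧-monoᶜ q q′
      rename-equivᶜ e e-∀ (a ∨ b) z∉a x-free =
        let (p , q)   = rename-equivᶜ e e-∀ a (z∉a ∘ inj₁) (x-free ∘ inj₁)
            (p′ , q′) = rename-equivᶜ e e-∀ b (z∉a ∘ inj₂) (x-free ∘ inj₂)
        in ∨-monoᶜ p p′ , ∨-monoᶜ q q′
      rename-equivᶜ e e-∀ (a · b) z∉a x-free =
        let (p , q)   = rename-equivᶜ e e-∀ a (z∉a ∘ inj₁) (x-free ∘ inj₁)
            (p′ , q′) = rename-equivᶜ e e-∀ b (z∉a ∘ inj₂) (x-free ∘ inj₂)
        in ·-monoᶜ p p′ , ·-monoᶜ q q′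
      rename-equivᶜ e e-∀ (∀p y a) z∉∀ya x-free with y ≟ x
      ... | yes refl =
        let (p , q) = rename-equiv-under-≐ a (z∉∀ya ∘ inj₂)
        in constᶜ (∀-rename x≢z (z∉∀ya ∘ inj₂) (rename-∉ x≢z a) p) ,
           constᶜ (∀-rename (x≢z ∘ ≡.sym) (rename-∉ x≢z a) (z∉∀ya ∘ inj₂) (syll (≐-sym _ _) q))
      ... | no  y≢x =
        let (p , q) = rename-equivᶜ e e-∀ a (z∉∀ya ∘ inj₂) (x-free ∘ (y≢x ∘ ≡.sym ,_))
            e-∀y    = e-∀ y≢x (z∉∀ya ∘ inj₁ ∘ ≡.sym)
        in ∀-monoᶜ y e-∀y p , ∀-monoᶜ y e-∀y q
      rename-equivᶜ e e-∀ (∃p y a) z∉∃ya x-free with y ≟ x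
      ... | yes refl =
        let (p , q) = rename-equiv-under-≐ a (z∉∃ya ∘ inj₂)
        in constᶜ (∃-rename x≢z (z∉∃ya ∘ inj₂) (rename-∉ x≢z a) (syll (≐-sym _ _) p)) ,
           constᶜ (∃-rename (x≢z ∘ ≡.sym) (rename-∉ x≢z a) (z∉∃ya ∘ inj₂) q)
      ... | no  y≢x =
        let (p , q) = rename-equivᶜ e e-∀ a (z∉∃ya ∘ inj₂) (x-free ∘ (y≢x ∘ ≡.sym ,_))
            e-∀y    = e-∀ y≢x (z∉∃ya ∘ inj₁ ∘ ≡.sym)
        in ∃-monoᶜ y e-∀y p , ∃-monoᶜ y e-∀y q

      rename-equiv-under-≐ a z∉a = rename-equivᶜ (var x ⟺ var z) ≐-∀ a z∉a (λ _ → ⌊⌋-elim _)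
        where
          ≐-∀ : ∀ {y} → y ≢ x → y ≢ z → Δ ⊢ ((var x ≐ var z) ⇒ ∀p y (var x ≐ var z))
          ≐-∀ y≢x y≢z = ax-∀-vac _ _ [ (λ ()) , [ [ y≢x , y≢z ]′ , [ y≢z , y≢x ]′ ]′ ]′

    notFree⇒∀ : ∀ x a → ¬ FreeIn x a → Δ ⊢ (a ⇒ ∀p x a)
    notFree⇒∀ x a x-not-free =
      syll (mp ⊢⌊⊤⌋ (proj₁ a⇔a′))
           (syll (ax-∀-vac x _ (rename-∉ x≢z a)) (∀-mono x (mp ⊢⌊⊤⌋ (proj₂ a⇔a′))))
      where
        z : EVar
        z = fresh (var x ∧ a)
        x≢z : x ≢ z
        x≢z = fresh-∉ (var x ∧ a) ∘ inj₁ ∘ ≡.sym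
        ⊤ : Pattern Σ
        ⊤ = ⊥p ⇒ ⊥p
        ⊢⌊⊤⌋ : Δ ⊢ ⌊ ⊤ ⌋
        ⊢⌊⊤⌋ = ⌊⌋-intro (⇒-refl ⊥p)
        ⌊⊤⌋-∀ : ∀ {y} → y ≢ x → y ≢ z → Δ ⊢ (⌊ ⊤ ⌋ ⇒ ∀p y ⌊ ⊤ ⌋)
        ⌊⊤⌋-∀ _ _ = ax-∀-vac _ _ [ (λ ()) , [ (λ ()) , (λ ()) ]′ ]′
        a⇔a′ : Δ ⊢ (⌊ ⊤ ⌋ ⇒ (a ⇒ rename x z a)) × Δ ⊢ (⌊ ⊤ ⌋ ⇒ (rename x z a ⇒ a))
        a⇔a′ = rename-equivᶜ x≢z ⊤ ⌊⊤⌋-∀ a (fresh-∉ (var x ∧ a) ∘ inj₂) (⊥-elim ∘ x-not-free)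

  module _ {Γ : PSet {Σ}} {φ : Pattern Σ} where

    deduction : Sentence φ → ∀ {a} → (Γ ∪｛ φ ｝) ⊢ a → Γ ⊢ (⌊ φ ⌋ ⇒ a)
    deduction φ-closed = ded
      where
        ded : ∀ {a} → (Γ ∪｛ φ ｝) ⊢ a → Γ ⊢ (⌊ φ ⌋ ⇒ a)
        ded (ax-∨-idem a)          = constᶜ (ax-∨-idem a)
        ded (ax-∧-dup a)           = constᶜ (ax-∧-dup a)
        ded (ax-∨-intro a b)       = constᶜ (ax-∨-intro a b)
        ded (ax-∧-elim a b)        = constᶜ (ax-∧-elim a b)
        ded (ax-∨-comm a b)        = constᶜ (ax-∨-comm a b)
        ded (ax-∧-comm a b)        = constᶜ (ax-∧-comm a b)
        ded (ax-⊥ a)               = constᶜ (ax-⊥ a)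
        ded (ax-lem a)             = constᶜ (ax-lem a)
        ded (ax-¬-elim a)          = constᶜ (ax-¬-elim a)
        ded (ax-¬-intro a)         = constᶜ (ax-¬-intro a)
        ded (ax-∀-K x a b)         = constᶜ (ax-∀-K x a b)
        ded (ax-∀-vac x a x∉a)     = constᶜ (ax-∀-vac x a x∉a)
        ded (ax-∃-eq x y x≢y)      = constᶜ (ax-∃-eq x y x≢y)
        ded (ax-∃-¬∀ x a)          = constᶜ (ax-∃-¬∀ x a)
        ded (ax-¬∀-∃ x a)          = constᶜ (ax-¬∀-∃ x a)
        ded (ax-prop-∨ˡ a b c)     = constᶜ (ax-prop-∨ˡ a b c)
        ded (ax-prop-∨ʳ a b c)     = constᶜ (ax-prop-∨ʳ a b c)
        ded (ax-prop-∃ˡ x a b x∉b) = constᶜ (ax-prop-∃ˡ x a b x∉b)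
        ded (ax-prop-∃ʳ x a b x∉b) = constᶜ (ax-prop-∃ʳ x a b x∉b)
        ded (ax-⌈⌉ˡ a b)           = constᶜ (ax-⌈⌉ˡ a b)
        ded (ax-⌈⌉ʳ a b)           = constᶜ (ax-⌈⌉ʳ a b)
        ded (ax-def-var x)         = constᶜ (ax-def-var x)
        ded (ax-⌈⌉-intro a)        = constᶜ (ax-⌈⌉-intro a)
        ded ax-⌈⊥⌉                 = constᶜ ax-⌈⊥⌉
        ded (hyp (inj₁ a∈Γ))       = constᶜ (hyp a∈Γ)
        ded (hyp (inj₂ refl))      = ⌊⌋-elim φ
        ded (mp p q)               = appᶜ (ded q) (ded p)
        ded (syll p q)             = ⇒-transᶜ (ded p) (ded q)
        ded (exp p)                = expᶜ (ded p)
        ded (imp p)                = impᶜ (ded p)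
        ded (∨-mono c p)           = ∨-monoᶜ ⇒-reflᶜ (ded p)
        ded (gen x p)              = genᶜ x (notFree⇒∀ x ⌊ φ ⌋ [ (λ ()) , φ-closed x ]′) (ded p)
        ded (frameˡ c p)           = plug-monoᶜ (appFrameˡ c) (ded p)
        ded (frameʳ c p)           = plug-monoᶜ (appFrameʳ c) (ded p)

    deduction⁻¹ : ∀ {a} → Γ ⊢ (⌊ φ ⌋ ⇒ a) → (Γ ∪｛ φ ｝) ⊢ a
    deduction⁻¹ p = mp (⌊⌋-intro (hyp (inj₂ refl))) (⊢-mono inj₁ p)

mainTheorem5 : {Σ : Set} (d : Σ) (Γ : PSet {Σ}) (ψ φ : Pattern Σ) →
    Sentence φ →
    Definedness._⊢_ d (Γ ∪｛ φ ｝) ψ ⇔ Definedness._⊢_ d Γ (Definedness.⌊_⌋ d φ ⇒ ψ)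
mainTheorem5 d Γ ψ φ φ-closed = mk⇔ (deduction d φ-closed) (deduction⁻¹ d)
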